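{- Let $P \in [0,1]^{n\times n}$ be an irreducible stochastic matrix with rational entries, and let $\pi \in (0,1]^n$ be its stationary distribution. Then $\pi$ is a vector of rational numbers whose lowest common denominator is not greater than $\min\{nD, nM^{n-1}\}$.
   Context: For each $i \in \{1,\dots,n\}$, $M_i$ denotes the lowest common denominator of the entries of the $i$-th row of $P$; $M$ denotes the lowest common denominator of all entries of $P$; and $D \coloneqq M_1 M_2 \cdots M_n$.
   Formalization: The stationary distribution π has rational entries throughout: its rationality is stated as existence of a rational stationary distribution, and the bound is asserted for every rational one. -}

module Defs where

open import Data.Nat using (ℕ; zero; suc)
import Data.Nat as ℕ
open import Data.Nat.LCM using (lcm)
open import Data.Fin using (Fin; zero; suc; _≟_)
open import Data.Rational using (ℚ; 0ℚ; 1ℚ; _+_; _*_; _<_; _≤_; ↧ₙ_)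
open import Data.Product using (∃)
open import Relation.Nullary using (yes; no)
open import Relation.Binary.PropositionalEquality using (_≡_)

Matrix : ℕ → Set
Matrix n = Fin n → Fin n → ℚ

Vector : ℕ → Set
Vector n = Fin n → ℚ

Σ : ∀ {n} → (Fin n → ℚ) → ℚ
Σ {zero}  f = 0ℚ
Σ {suc n} f = f zero + Σ (λ i → f (suc i))

Πℕ : ∀ {n} → (Fin n → ℕ) → ℕ
Πℕ {zero}  f = 1
Πℕ {suc n} f = f zero ℕ.* Πℕ (λ i → f (suc i))

lcd : ∀ {n} → Vector n → ℕ
lcd {zero}  v = 1
lcd {suc n} v = lcm (↧ₙ v zero) (lcd (λ i → v (suc i)))

I : ∀ {n} → Matrix n
I i j with i ≟ j
... | yes _ = 1ℚ
... | no  _ = 0ℚ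

_⊗_ : ∀ {n} → Matrix n → Matrix n → Matrix n
(A ⊗ B) i j = Σ (λ k → A i k * B k j)

_^ᴹ_ : ∀ {n} → Matrix n → ℕ → Matrix n
A ^ᴹ zero  = I
A ^ᴹ suc k = A ⊗ (A ^ᴹ k)

Stochastic : ∀ {n} → Matrix n → Set
Stochastic P = (∀ i j → 0ℚ ≤ P i j) × (∀ i j → P i j ≤ 1ℚ) × (∀ i → Σ (P i) ≡ 1ℚ)
  where open import Data.Product using (_×_)

Irreducible : ∀ {n} → Matrix n → Set
Irreducible P = ∀ i j → ∃ λ k → 0ℚ < (P ^ᴹ k) i j

StationaryDistribution : ∀ {n} → Matrix n → Vector n → Set
StationaryDistribution P π =
  (∀ i → 0ℚ < π i) × (∀ i → π i ≤ 1ℚ) × (Σ π ≡ 1ℚ) ×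
  (∀ j → Σ (λ i → π i * P i j) ≡ π j)
  where open import Data.Product using (_×_)

-- M_i : lcd of row i; M : lcd of all entries; D = M_1 ⋯ M_n
rowLcd : ∀ {n} → Matrix n → Fin n → ℕ
rowLcd P i = lcd (P i)

lcmℕ : ∀ {n} → (Fin n → ℕ) → ℕ
lcmℕ {zero}  f = 1
lcmℕ {suc n} f = lcm (f zero) (lcmℕ (λ i → f (suc i)))

lcdAll : ∀ {n} → Matrix n → ℕ
lcdAll P = lcmℕ (rowLcd P)

Dprod : ∀ {n} → Matrix n → ℕ
Dprod P = Πℕ (rowLcd P)

-- Scale row i of P by a common multiple cᵢ of its denominators: the weights wᵢₖ = cᵢ Pᵢₖ
-- are natural numbers with row sums cᵢ. By the Markov chain tree theorem the total weights Tⱼ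
-- of the spanning trees directed towards j satisfy Σᵢ Tᵢ wᵢⱼ = Tⱼ cⱼ, so y = (Tⱼ cⱼ)ⱼ is an
-- invariant vector of naturals, positive because an irreducible chain has a spanning tree of
-- positive edges. Irreducibility also makes every stationary distribution a multiple of y, so
-- π = y / Σ y and lcd π divides Σⱼ yⱼ. Since Tⱼ ≤ Πₗ≠ⱼ cₗ, taking cᵢ = Mᵢ gives Σ y ≤ nD;
-- taking cᵢ = M, T itself is invariant and Σ T ≤ n M^(n-1).
module Submission where

open import Algebra.Bundles using (CommutativeMonoid; Ring)
open import Data.Bool using (if_then_else_)
open import Data.Empty using (⊥; ⊥-elim)
open import Data.Fin using (Fin; zero; suc; toℕ; fromℕ<; punchIn; _≟_)
import Data.Fin.Properties as Finₚ
open import Data.Nat using (ℕ; zero; suc)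
open import Data.Product using (∃; ∃-syntax; _×_; _,_; proj₁; proj₂)
open import Data.Sum using (_⊎_; inj₁; inj₂)
open import Function using (_∘_)
open import Relation.Binary.PropositionalEquality
  using (_≡_; _≢_; refl; sym; trans; cong; cong₂; cong-app; subst; subst₂; module ≡-Reasoning)
open import Relation.Nullary using (Dec; yes; no; ¬_; does)
open import Relation.Nullary.Decidable using (map′; dec-true; dec-false)
open import Defs

module _ {c ℓ} (M : CommutativeMonoid c ℓ) where

  open CommutativeMonoid M
  open import Algebra.Properties.CommutativeMonoid.Sum M
    using (sum; sum-remove; sum-cong-≋; sum-replicate-zero)
  open import Relation.Binary.Reasoning.Setoid setoid

  sum-concentrated : ∀ {m} (f : Fin m → Carrier) a → (∀ i → i ≢ a → f i ≈ ε) → sum f ≈ f a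
  sum-concentrated {suc m} f a vanishes = begin
    sum f                              ≈⟨ sum-remove {i = a} f ⟩
    f a ∙ sum (λ i → f (punchIn a i))  ≈⟨ ∙-congˡ (sum-cong-≋ {m} (λ i → vanishes _ (Finₚ.punchInᵢ≢i a i))) ⟩
    f a ∙ sum {m} (λ _ → ε)            ≈⟨ ∙-congˡ (sum-replicate-zero m) ⟩
    f a ∙ ε                            ≈⟨ identityʳ (f a) ⟩
    f a                                ∎

module Trees where

  open import Data.Nat using (_+_; _*_; _∸_; _^_; _≤_; _<_; _<?_; z≤n; s≤s; s≤s⁻¹)
  open import Data.Nat.Properties hiding (_≟_)
  open import Algebra.Properties.Semiring.Sum +-*-semiring
    using (sum; sum-cong-≗; sum-replicate-zero; ∑-comm; *-distribˡ-sum; *-distribʳ-sum)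

  module RootedMaps {n : ℕ} where

    open import Data.Nat.Induction using (<-rec)
    open import Function.Endo.Propositional (Fin n) using (^-homo) renaming (_^_ to _^ᶠ_) public
    open ≡-Reasoning

    Reaches : (Fin n → Fin n) → Fin n → Fin n → Set
    Reaches G v r = ∃[ k ] (G ^ᶠ k) v ≡ r

    -- Rooted G r: deleting the edge r ↦ G r from the functional graph of G leaves a spanning
    -- tree directed towards r.
    Rooted : (Fin n → Fin n) → Fin n → Set
    Rooted G r = ∀ v → Reaches G v r

    ^ᶠ-+ : ∀ G k l v → (G ^ᶠ (k + l)) v ≡ (G ^ᶠ k) ((G ^ᶠ l) v)
    ^ᶠ-+ G k l v = cong-app (^-homo G k l) v

    ^ᶠ-sucʳ : ∀ G k v → (G ^ᶠ suc k) v ≡ (G ^ᶠ k) (G v)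
    ^ᶠ-sucʳ G k v = trans (cong (λ m → (G ^ᶠ m) v) (+-comm 1 k)) (^ᶠ-+ G k 1 v)

    reaches-trans : ∀ {G u v w} → Reaches G u v → Reaches G v w → Reaches G u w
    reaches-trans {G} {u} (k , p) (l , q) = l + k , trans (^ᶠ-+ G l k u) (trans (cong (G ^ᶠ l) p) q)

    rooted-successor : ∀ {G r} → Rooted G r → Rooted G (G r)
    rooted-successor rooted v = reaches-trans (rooted v) (1 , refl)

    rooted-predecessor : ∀ {G r} → Rooted G r → ∃[ i ] Rooted G i × G i ≡ r
    rooted-predecessor {G} {r} rooted with rooted (G r)
    ... | k , p = (G ^ᶠ k) r , (λ v → reaches-trans (rooted v) (k , refl)) , trans (^ᶠ-sucʳ G k r) p

    returns-agree : ∀ G x a b → (G ^ᶠ suc a) x ≡ x → (G ^ᶠ suc b) x ≡ x → (G ^ᶠ a) x ≡ (G ^ᶠ b) x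
    returns-agree G x a b pa pb = begin
      (G ^ᶠ a) x                 ≡⟨ cong (G ^ᶠ a) (sym pb) ⟩
      (G ^ᶠ a) ((G ^ᶠ suc b) x)  ≡⟨ sym (^ᶠ-+ G a (suc b) x) ⟩
      (G ^ᶠ (a + suc b)) x       ≡⟨ cong (λ m → (G ^ᶠ m) x) a+1+b≡b+1+a ⟩
      (G ^ᶠ (b + suc a)) x       ≡⟨ ^ᶠ-+ G b (suc a) x ⟩
      (G ^ᶠ b) ((G ^ᶠ suc a) x)  ≡⟨ cong (G ^ᶠ b) pa ⟩
      (G ^ᶠ b) x                 ∎
      where
      a+1+b≡b+1+a : a + suc b ≡ b + suc a
      a+1+b≡b+1+a = trans (+-suc a b) (trans (cong suc (+-comm a b)) (sym (+-suc b a)))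

    -- i and i' both lie on the cycle through G i, and G returns to G i from either.
    rooted-injective : ∀ {G i i'} → Rooted G i → Rooted G i' → G i ≡ G i' → i ≡ i'
    rooted-injective {G} {i} {i'} rooted rooted' eq with rooted (G i) | rooted' (G i)
    ... | a , pa | b , pb =
      trans (sym pa) (trans (returns-agree G (G i) a b (cong G pa) (trans (cong G pb) (sym eq))) pb)

    reaches-cong : ∀ {G G' r} → (∀ v → v ≢ r → G v ≡ G' v) → ∀ k v → (G ^ᶠ k) v ≡ r → Reaches G' v r
    reaches-cong agree zero v p = 0 , p
    reaches-cong {G} {G'} {r} agree (suc k) v p with v ≟ r
    ... | yes v≡r = 0 , v≡r
    ... | no v≢r with reaches-cong agree k (G v) (trans (sym (^ᶠ-sucʳ G k v)) p)
    ...   | k' , p' = suc k' , trans (^ᶠ-sucʳ G' k' v) (trans (cong (G' ^ᶠ k') (sym (agree v v≢r))) p')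

    rooted-cong : ∀ {G G' r} → (∀ v → v ≢ r → G v ≡ G' v) → Rooted G r → Rooted G' r
    rooted-cong agree rooted v = reaches-cong agree (proj₁ (rooted v)) v (proj₂ (rooted v))

    -- Two of the first n + 1 iterates coincide; cut out the loop between them.
    shortcut : ∀ G v k → n ≤ k → ∃[ k' ] k' < k × (G ^ᶠ k') v ≡ (G ^ᶠ k) v
    shortcut G v k n≤k with Finₚ.pigeonhole (n<1+n n) (λ t → (G ^ᶠ toℕ t) v)
    ... | a , b , a<b , loop = d + toℕ a , subst (d + toℕ a <_) d+b≡k (+-monoʳ-< d a<b) , (begin
      (G ^ᶠ (d + toℕ a)) v        ≡⟨ ^ᶠ-+ G d (toℕ a) v ⟩
      (G ^ᶠ d) ((G ^ᶠ toℕ a) v)   ≡⟨ cong (G ^ᶠ d) loop ⟩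
      (G ^ᶠ d) ((G ^ᶠ toℕ b) v)   ≡⟨ sym (^ᶠ-+ G d (toℕ b) v) ⟩
      (G ^ᶠ (d + toℕ b)) v        ≡⟨ cong (λ m → (G ^ᶠ m) v) d+b≡k ⟩
      (G ^ᶠ k) v                  ∎)
      where
      d = k ∸ toℕ b
      d+b≡k : d + toℕ b ≡ k
      d+b≡k = m∸n+n≡m (≤-trans (s≤s⁻¹ (Finₚ.toℕ<n b)) n≤k)

    reaches-within : ∀ {G v r} → Reaches G v r → ∃ λ (i : Fin n) → (G ^ᶠ toℕ i) v ≡ r
    reaches-within {G} {v} {r} (k , p) = <-rec Within go k p
      where
      Within : ℕ → Set
      Within k = (G ^ᶠ k) v ≡ r → ∃ λ (i : Fin n) → (G ^ᶠ toℕ i) v ≡ r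
      go : ∀ k → (∀ {k'} → k' < k → Within k') → Within k
      go k shorter p with k <? n
      ... | yes k<n = fromℕ< k<n , subst (λ m → (G ^ᶠ m) v ≡ r) (sym (Finₚ.toℕ-fromℕ< k<n)) p
      ... | no k≮n with shortcut G v k (≮⇒≥ k≮n)
      ...   | k' , k'<k , q = shorter k'<k (trans q p)

    rooted? : ∀ G r → Dec (Rooted G r)
    rooted? G r = map′ (λ h v → toℕ (proj₁ (h v)) , proj₂ (h v)) (λ h v → reaches-within (h v))
                       (Finₚ.all? λ v → Finₚ.any? λ i → (G ^ᶠ toℕ i) v ≟ r)

  open RootedMaps

  sumℕ-concentrated : ∀ {m} (f : Fin m → ℕ) a → (∀ i → i ≢ a → f i ≡ 0) → sum f ≡ f a
  sumℕ-concentrated = sum-concentrated +-0-commutativeMonoid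

  sum-zero : ∀ {m} (f : Fin m → ℕ) → (∀ i → f i ≡ 0) → sum f ≡ 0
  sum-zero {m} f vanishes = trans (sum-cong-≗ vanishes) (sum-replicate-zero m)

  ≤-sum : ∀ {m} (f : Fin m → ℕ) a → f a ≤ sum f
  ≤-sum f zero    = m≤m+n _ _
  ≤-sum f (suc a) = ≤-trans (≤-sum (λ i → f (suc i)) a) (m≤n+m _ _)

  sum-mono-≤ : ∀ {m} {f g : Fin m → ℕ} → (∀ i → f i ≤ g i) → sum f ≤ sum g
  sum-mono-≤ {zero}  f≤g = z≤n
  sum-mono-≤ {suc m} f≤g = +-mono-≤ (f≤g zero) (sum-mono-≤ (λ i → f≤g (suc i)))

  sum-≤-* : ∀ {m} (f : Fin m → ℕ) {B} → (∀ i → f i ≤ B) → sum f ≤ m * B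
  sum-≤-* {zero}  f f≤B = z≤n
  sum-≤-* {suc m} f f≤B = +-mono-≤ (f≤B zero) (sum-≤-* (λ i → f (suc i)) (λ i → f≤B (suc i)))

  𝟙 : ∀ {p} {P : Set p} → Dec P → ℕ
  𝟙 d = if does d then 1 else 0

  𝟙-true : ∀ {p} {P : Set p} (d : Dec P) → P → 𝟙 d ≡ 1
  𝟙-true d x = cong (λ b → if b then 1 else 0) (dec-true d x)

  𝟙-false : ∀ {p} {P : Set p} (d : Dec P) → ¬ P → 𝟙 d ≡ 0
  𝟙-false d ¬x = cong (λ b → if b then 1 else 0) (dec-false d ¬x)

  𝟙-pos : ∀ {p} {P : Set p} (d : Dec P) → P → 0 < 𝟙 d
  𝟙-pos d x = subst (0 <_) (sym (𝟙-true d x)) (s≤s z≤n)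

  𝟙≤1 : ∀ {p} {P : Set p} (d : Dec P) → 𝟙 d ≤ 1
  𝟙≤1 (yes _) = s≤s z≤n
  𝟙≤1 (no _)  = z≤n

  𝟙-⇔ : ∀ {p q} {P : Set p} {Q : Set q} → (P → Q) → (Q → P) → (d : Dec P) (d' : Dec Q) → 𝟙 d ≡ 𝟙 d'
  𝟙-⇔ to from (yes x) d' = sym (𝟙-true d' (to x))
  𝟙-⇔ to from (no ¬x) d' = sym (𝟙-false d' (¬x ∘ from))

  𝟙*𝟙≡0 : ∀ {p q} {P : Set p} {Q : Set q} (d : Dec P) (e : Dec Q) → (P → Q → ⊥) → 𝟙 d * 𝟙 e ≡ 0
  𝟙*𝟙≡0 (yes x) (yes y) ¬xy = ⊥-elim (¬xy x y)
  𝟙*𝟙≡0 (yes _) (no _)  _   = refl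
  𝟙*𝟙≡0 (no _)  _       _   = refl

  sum-𝟙ˡ : ∀ {m} (x : Fin m) → sum (λ a → 𝟙 (a ≟ x)) ≡ 1
  sum-𝟙ˡ x = trans (sumℕ-concentrated _ x (λ a a≢x → 𝟙-false (a ≟ x) a≢x)) (𝟙-true (x ≟ x) refl)

  sum-𝟙ʳ : ∀ {m} (x : Fin m) → sum (λ a → 𝟙 (x ≟ a)) ≡ 1
  sum-𝟙ʳ x = trans (sumℕ-concentrated _ x (λ a a≢x → 𝟙-false (x ≟ a) (a≢x ∘ sym))) (𝟙-true (x ≟ x) refl)

  Πℕ-cong : ∀ {m} {f g : Fin m → ℕ} → (∀ i → f i ≡ g i) → Πℕ f ≡ Πℕ g
  Πℕ-cong {zero}  f≡g = refl
  Πℕ-cong {suc m} f≡g = cong₂ _*_ (f≡g zero) (Πℕ-cong (λ i → f≡g (suc i)))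

  Πℕ-pos : ∀ {m} (f : Fin m → ℕ) → (∀ i → 0 < f i) → 0 < Πℕ f
  Πℕ-pos {zero}  f pos = s≤s z≤n
  Πℕ-pos {suc m} f pos = *-mono-< (pos zero) (Πℕ-pos (λ i → f (suc i)) (λ i → pos (suc i)))

  Πℕ-except : ∀ {m} → Fin m → (Fin m → ℕ) → ℕ
  Πℕ-except j f = Πℕ (λ l → if does (l ≟ j) then 1 else f l)

  Πℕ-split : ∀ {m} (f : Fin m → ℕ) j → Πℕ f ≡ Πℕ-except j f * f j
  Πℕ-split f zero = begin
    f zero * Πℕ (λ l → f (suc l))   ≡⟨ *-comm (f zero) _ ⟩
    Πℕ (λ l → f (suc l)) * f zero   ≡⟨ cong (_* f zero) (sym (*-identityˡ (Πℕ (λ l → f (suc l))))) ⟩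
    Πℕ-except zero f * f zero       ∎
    where open ≡-Reasoning
  Πℕ-split f (suc j) = begin
    f zero * Πℕ (λ l → f (suc l))                         ≡⟨ cong (f zero *_) (Πℕ-split (λ l → f (suc l)) j) ⟩
    f zero * (Πℕ-except j (λ l → f (suc l)) * f (suc j))  ≡⟨ sym (*-assoc (f zero) _ _) ⟩
    Πℕ-except (suc j) f * f (suc j)                       ∎
    where open ≡-Reasoning

  Πℕ-except-const : ∀ {m} (j : Fin (suc m)) x → Πℕ-except j (λ _ → x) ≡ x ^ m
  Πℕ-except-const {m} zero x = trans (*-identityˡ _) (Πℕ-const m)
    where
    Πℕ-const : ∀ k → Πℕ {k} (λ _ → x) ≡ x ^ k
    Πℕ-const zero    = refl
    Πℕ-const (suc k) = cong (x *_) (Πℕ-const k)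
  Πℕ-except-const {suc m} (suc j) x = cong (x *_) (Πℕ-except-const j x)

  module MapSums {n : ℕ} where

    open import Data.Vec using (Vec; []; _∷_; lookup)
    open ≡-Reasoning

    ∑ᵐ : ∀ m → (Vec (Fin n) m → ℕ) → ℕ
    ∑ᵐ zero    F = F []
    ∑ᵐ (suc m) F = sum (λ a → ∑ᵐ m (λ g → F (a ∷ g)))

    ∑ᵐ-cong : ∀ m {F F' : Vec (Fin n) m → ℕ} → (∀ g → F g ≡ F' g) → ∑ᵐ m F ≡ ∑ᵐ m F'
    ∑ᵐ-cong zero    eq = eq []
    ∑ᵐ-cong (suc m) eq = sum-cong-≗ (λ a → ∑ᵐ-cong m (λ g → eq (a ∷ g)))

    *-distribˡ-∑ᵐ : ∀ m x (F : Vec (Fin n) m → ℕ) → x * ∑ᵐ m F ≡ ∑ᵐ m (λ g → x * F g)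
    *-distribˡ-∑ᵐ zero    x F = refl
    *-distribˡ-∑ᵐ (suc m) x F = trans (*-distribˡ-sum x (λ a → ∑ᵐ m (λ g → F (a ∷ g))))
                                      (sum-cong-≗ (λ a → *-distribˡ-∑ᵐ m x (λ g → F (a ∷ g))))

    *-distribʳ-∑ᵐ : ∀ m x (F : Vec (Fin n) m → ℕ) → ∑ᵐ m F * x ≡ ∑ᵐ m (λ g → F g * x)
    *-distribʳ-∑ᵐ zero    x F = refl
    *-distribʳ-∑ᵐ (suc m) x F = trans (*-distribʳ-sum x (λ a → ∑ᵐ m (λ g → F (a ∷ g))))
                                      (sum-cong-≗ (λ a → *-distribʳ-∑ᵐ m x (λ g → F (a ∷ g))))

    ∑ᵐ-sum : ∀ m {k} (F : Fin k → Vec (Fin n) m → ℕ) →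
             ∑ᵐ m (λ g → sum (λ i → F i g)) ≡ sum (λ i → ∑ᵐ m (F i))
    ∑ᵐ-sum zero    F = refl
    ∑ᵐ-sum (suc m) F = trans (sum-cong-≗ (λ a → ∑ᵐ-sum m (λ i g → F i (a ∷ g))))
                             (∑-comm (λ a i → ∑ᵐ m (λ g → F i (a ∷ g))))

    ≤-∑ᵐ : ∀ m (F : Vec (Fin n) m → ℕ) g → F g ≤ ∑ᵐ m F
    ≤-∑ᵐ zero    F []      = ≤-refl
    ≤-∑ᵐ (suc m) F (a ∷ g) = ≤-trans (≤-∑ᵐ m (λ g → F (a ∷ g)) g) (≤-sum (λ a → ∑ᵐ m (λ g → F (a ∷ g))) a)

    ∑ᵐ-mono-≤ : ∀ m {F F' : Vec (Fin n) m → ℕ} → (∀ g → F g ≤ F' g) → ∑ᵐ m F ≤ ∑ᵐ m F'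
    ∑ᵐ-mono-≤ zero    F≤F' = F≤F' []
    ∑ᵐ-mono-≤ (suc m) F≤F' = sum-mono-≤ (λ a → ∑ᵐ-mono-≤ m (λ g → F≤F' (a ∷ g)))

    ∑ᵐ-Πℕ : ∀ m (c : Fin m → Fin n → ℕ) → ∑ᵐ m (λ g → Πℕ (λ l → c l (lookup g l))) ≡ Πℕ (λ l → sum (c l))
    ∑ᵐ-Πℕ zero    c = refl
    ∑ᵐ-Πℕ (suc m) c = begin
      sum (λ a → ∑ᵐ m (λ g → c zero a * Πℕ (λ l → c (suc l) (lookup g l))))
        ≡⟨ sum-cong-≗ (λ a → sym (*-distribˡ-∑ᵐ m (c zero a) _)) ⟩
      sum (λ a → c zero a * ∑ᵐ m (λ g → Πℕ (λ l → c (suc l) (lookup g l))))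
        ≡⟨ sum-cong-≗ (λ a → cong (c zero a *_) (∑ᵐ-Πℕ m (λ l → c (suc l)))) ⟩
      sum (λ a → c zero a * Πℕ (λ l → sum (c (suc l))))
        ≡⟨ sym (*-distribʳ-sum (Πℕ (λ l → sum (c (suc l)))) (c zero)) ⟩
      sum (c zero) * Πℕ (λ l → sum (c (suc l)))
        ∎

    ∑ᵐ-fibre : ∀ m (i : Fin m) (F : Vec (Fin n) m → ℕ) →
               (∀ g g' → (∀ l → l ≢ i → lookup g l ≡ lookup g' l) → F g ≡ F g') →
               ∀ a b → ∑ᵐ m (λ g → 𝟙 (lookup g i ≟ a) * F g) ≡ ∑ᵐ m (λ g → 𝟙 (lookup g i ≟ b) * F g)
    ∑ᵐ-fibre (suc m) zero F local a b =
      trans (fibre a) (trans (∑ᵐ-cong m (λ g → local (a ∷ g) (b ∷ g) off-head)) (sym (fibre b)))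
      where
      off-head : ∀ {g} l → l ≢ zero → lookup (a ∷ g) l ≡ lookup (b ∷ g) l
      off-head zero    l≢0 = ⊥-elim (l≢0 refl)
      off-head (suc l) _   = refl
      fibre : ∀ a → ∑ᵐ (suc m) (λ g → 𝟙 (lookup g zero ≟ a) * F g) ≡ ∑ᵐ m (λ g → F (a ∷ g))
      fibre a = begin
        sum (λ x → ∑ᵐ m (λ g → 𝟙 (x ≟ a) * F (x ∷ g)))
          ≡⟨ sum-cong-≗ (λ x → sym (*-distribˡ-∑ᵐ m (𝟙 (x ≟ a)) _)) ⟩
        sum (λ x → 𝟙 (x ≟ a) * ∑ᵐ m (λ g → F (x ∷ g)))
          ≡⟨ sumℕ-concentrated _ a (λ x x≢a → cong (_* ∑ᵐ m (λ g → F (x ∷ g))) (𝟙-false (x ≟ a) x≢a)) ⟩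
        𝟙 (a ≟ a) * ∑ᵐ m (λ g → F (a ∷ g))
          ≡⟨ cong (_* ∑ᵐ m (λ g → F (a ∷ g))) (𝟙-true (a ≟ a) refl) ⟩
        1 * ∑ᵐ m (λ g → F (a ∷ g))
          ≡⟨ *-identityˡ _ ⟩
        ∑ᵐ m (λ g → F (a ∷ g))
          ∎
    ∑ᵐ-fibre (suc m) (suc i) F local a b =
      sum-cong-≗ (λ x → ∑ᵐ-fibre m i (λ g → F (x ∷ g))
                                 (λ g g' agree → local (x ∷ g) (x ∷ g') (lift agree)) a b)
      where
      lift : ∀ {x g g'} → (∀ l → l ≢ i → lookup g l ≡ lookup g' l) →
             ∀ l → l ≢ suc i → lookup (x ∷ g) l ≡ lookup (x ∷ g') l
      lift agree zero    _     = refl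
      lift agree (suc l) l≢1+i = agree l (l≢1+i ∘ cong suc)

  root-count : ∀ {n} (G : Fin n → Fin n) j → sum (λ i → 𝟙 (G i ≟ j) * 𝟙 (rooted? G i)) ≡ 𝟙 (rooted? G j)
  root-count G j = count (rooted? G j)
    where
    count : (d : Dec (Rooted G j)) → sum (λ i → 𝟙 (G i ≟ j) * 𝟙 (rooted? G i)) ≡ 𝟙 d
    count (no ¬rooted-j) = sum-zero _ (λ i → 𝟙*𝟙≡0 (G i ≟ j) (rooted? G i)
      (λ Gi≡j rooted-i → ¬rooted-j (subst (Rooted G) Gi≡j (rooted-successor rooted-i))))
    count (yes rooted-j) with rooted-predecessor rooted-j
    ... | i , rooted-i , Gi≡j = trans
      (sumℕ-concentrated _ i (λ i' i'≢i → 𝟙*𝟙≡0 (G i' ≟ j) (rooted? G i') (λ Gi'≡j rooted-i' →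
         i'≢i (rooted-injective rooted-i' rooted-i (trans Gi'≡j (sym Gi≡j))))))
      (cong₂ _*_ (𝟙-true (G i ≟ j) Gi≡j) (𝟙-true (rooted? G i) rooted-i))

  module TreeSums {n : ℕ} (w : Fin n → Fin n → ℕ) where

    open import Data.Vec using (Vec; lookup; tabulate)
    open import Data.Vec.Properties using (lookup∘tabulate)
    open MapSums
    open ≡-Reasoning

    edge : Vec (Fin n) n → Fin n → ℕ
    edge g l = w l (lookup g l)

    isRooted : Fin n → Vec (Fin n) n → ℕ
    isRooted j g = 𝟙 (rooted? (lookup g) j)

    weight : Vec (Fin n) n → ℕ
    weight g = Πℕ (edge g)

    rootedWeight : Fin n → Vec (Fin n) n → ℕ
    rootedWeight j g = isRooted j g * weight g

    treeWeight : Fin n → Vec (Fin n) n → ℕ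
    treeWeight j g = isRooted j g * Πℕ-except j (edge g)

    -- The total weight of the spanning trees directed towards j, a tree being encoded by the
    -- map g with g j = j; by treeSum-fibre any other value of g j gives the same sum.
    treeSum : Fin n → ℕ
    treeSum j = ∑ᵐ n (λ g → 𝟙 (lookup g j ≟ j) * treeWeight j g)

    treeWeight-local : ∀ j g g' → (∀ l → l ≢ j → lookup g l ≡ lookup g' l) → treeWeight j g ≡ treeWeight j g'
    treeWeight-local j g g' agree = cong₂ _*_
      (𝟙-⇔ (rooted-cong agree) (rooted-cong (λ v v≢j → sym (agree v v≢j)))
           (rooted? (lookup g) j) (rooted? (lookup g') j))
      (Πℕ-cong off-root)
      where
      off-root : ∀ l → (if does (l ≟ j) then 1 else edge g l) ≡ (if does (l ≟ j) then 1 else edge g' l)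
      off-root l with l ≟ j
      ... | yes _   = refl
      ... | no l≢j = cong (w l) (agree l l≢j)

    treeSum-fibre : ∀ j a → treeSum j ≡ ∑ᵐ n (λ g → 𝟙 (lookup g j ≟ a) * treeWeight j g)
    treeSum-fibre j a = ∑ᵐ-fibre n j (treeWeight j) (treeWeight-local j) j a

    fibre-weight : ∀ i a g → 𝟙 (lookup g i ≟ a) * treeWeight i g * w i a ≡ 𝟙 (lookup g i ≟ a) * rootedWeight i g
    fibre-weight i a g with lookup g i ≟ a
    ... | no _      = refl
    ... | yes gi≡a = begin
      1 * (R * E) * w i a         ≡⟨ cong (_* w i a) (*-identityˡ (R * E)) ⟩
      R * E * w i a               ≡⟨ *-assoc R E (w i a) ⟩
      R * (E * w i a)             ≡⟨ cong (λ x → R * (E * w i x)) (sym gi≡a) ⟩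
      R * (E * edge g i)          ≡⟨ cong (R *_) (sym (Πℕ-split (edge g) i)) ⟩
      R * weight g                ≡⟨ sym (*-identityˡ (R * weight g)) ⟩
      1 * (R * weight g)          ∎
      where
      R = isRooted i g
      E = Πℕ-except i (edge g)

    treeSum-* : ∀ i a → treeSum i * w i a ≡ ∑ᵐ n (λ g → 𝟙 (lookup g i ≟ a) * rootedWeight i g)
    treeSum-* i a = begin
      treeSum i * w i a                                          ≡⟨ cong (_* w i a) (treeSum-fibre i a) ⟩
      ∑ᵐ n (λ g → 𝟙 (lookup g i ≟ a) * treeWeight i g) * w i a  ≡⟨ *-distribʳ-∑ᵐ n (w i a) _ ⟩
      ∑ᵐ n (λ g → 𝟙 (lookup g i ≟ a) * treeWeight i g * w i a)  ≡⟨ ∑ᵐ-cong n (fibre-weight i a) ⟩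
      ∑ᵐ n (λ g → 𝟙 (lookup g i ≟ a) * rootedWeight i g)        ∎

    inflow : ∀ j → sum (λ i → treeSum i * w i j) ≡ ∑ᵐ n (rootedWeight j)
    inflow j = begin
      sum (λ i → treeSum i * w i j)                                    ≡⟨ sum-cong-≗ (λ i → treeSum-* i j) ⟩
      sum (λ i → ∑ᵐ n (λ g → 𝟙 (lookup g i ≟ j) * rootedWeight i g))  ≡⟨ sym (∑ᵐ-sum n F) ⟩
      ∑ᵐ n (λ g → sum (λ i → F i g))                                   ≡⟨ ∑ᵐ-cong n unique-root ⟩
      ∑ᵐ n (rootedWeight j)                                            ∎
      where
      F : Fin n → Vec (Fin n) n → ℕ
      F i g = 𝟙 (lookup g i ≟ j) * rootedWeight i g
      unique-root : ∀ g → sum (λ i → F i g) ≡ rootedWeight j g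
      unique-root g = begin
        sum (λ i → 𝟙 (lookup g i ≟ j) * (isRooted i g * weight g))
          ≡⟨ sum-cong-≗ (λ i → sym (*-assoc (𝟙 (lookup g i ≟ j)) (isRooted i g) (weight g))) ⟩
        sum (λ i → 𝟙 (lookup g i ≟ j) * isRooted i g * weight g)
          ≡⟨ sym (*-distribʳ-sum (weight g) (λ i → 𝟙 (lookup g i ≟ j) * isRooted i g)) ⟩
        sum (λ i → 𝟙 (lookup g i ≟ j) * isRooted i g) * weight g
          ≡⟨ cong (_* weight g) (root-count (lookup g) j) ⟩
        rootedWeight j g
          ∎

    outflow : ∀ j → treeSum j * sum (w j) ≡ ∑ᵐ n (rootedWeight j)
    outflow j = begin
      treeSum j * sum (w j)                                            ≡⟨ *-distribˡ-sum (treeSum j) (w j) ⟩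
      sum (λ a → treeSum j * w j a)                                    ≡⟨ sum-cong-≗ (treeSum-* j) ⟩
      sum (λ a → ∑ᵐ n (λ g → 𝟙 (lookup g j ≟ a) * rootedWeight j g))  ≡⟨ sym (∑ᵐ-sum n F) ⟩
      ∑ᵐ n (λ g → sum (λ a → F a g))                                   ≡⟨ ∑ᵐ-cong n one-out-edge ⟩
      ∑ᵐ n (rootedWeight j)                                            ∎
      where
      F : Fin n → Vec (Fin n) n → ℕ
      F a g = 𝟙 (lookup g j ≟ a) * rootedWeight j g
      one-out-edge : ∀ g → sum (λ a → F a g) ≡ rootedWeight j g
      one-out-edge g = begin
        sum (λ a → 𝟙 (lookup g j ≟ a) * rootedWeight j g)
          ≡⟨ sym (*-distribʳ-sum (rootedWeight j g) (λ a → 𝟙 (lookup g j ≟ a))) ⟩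
        sum (λ a → 𝟙 (lookup g j ≟ a)) * rootedWeight j g
          ≡⟨ cong (_* rootedWeight j g) (sum-𝟙ʳ (lookup g j)) ⟩
        1 * rootedWeight j g
          ≡⟨ *-identityˡ (rootedWeight j g) ⟩
        rootedWeight j g
          ∎

    markov-chain-tree : ∀ j → sum (λ i → treeSum i * w i j) ≡ treeSum j * sum (w j)
    markov-chain-tree j = trans (inflow j) (sym (outflow j))

    treeSum-≤ : ∀ j → treeSum j ≤ Πℕ-except j (λ l → sum (w l))
    treeSum-≤ j = ≤-trans (∑ᵐ-mono-≤ n drop-rooted) (≤-reflexive (begin
      ∑ᵐ n (λ g → 𝟙 (lookup g j ≟ j) * Πℕ-except j (edge g))  ≡⟨ ∑ᵐ-cong n as-product ⟩
      ∑ᵐ n (λ g → Πℕ (λ l → c l (lookup g l)))                 ≡⟨ ∑ᵐ-Πℕ n c ⟩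
      Πℕ (λ l → sum (c l))                                     ≡⟨ Πℕ-cong row-sum ⟩
      Πℕ-except j (λ l → sum (w l))                            ∎))
      where
      c : Fin n → Fin n → ℕ
      c l a = if does (l ≟ j) then 𝟙 (a ≟ j) else w l a
      drop-rooted : ∀ g → 𝟙 (lookup g j ≟ j) * treeWeight j g ≤ 𝟙 (lookup g j ≟ j) * Πℕ-except j (edge g)
      drop-rooted g = *-monoʳ-≤ (𝟙 (lookup g j ≟ j))
        (≤-trans (*-monoˡ-≤ _ (𝟙≤1 (rooted? (lookup g) j))) (≤-reflexive (*-identityˡ _)))
      as-product : ∀ g → 𝟙 (lookup g j ≟ j) * Πℕ-except j (edge g) ≡ Πℕ (λ l → c l (lookup g l))
      as-product g = sym (begin
        Πℕ (λ l → c l (lookup g l))                               ≡⟨ Πℕ-split (λ l → c l (lookup g l)) j ⟩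
        Πℕ-except j (λ l → c l (lookup g l)) * c j (lookup g j)   ≡⟨ cong₂ _*_ (Πℕ-cong off-root) root ⟩
        Πℕ-except j (edge g) * 𝟙 (lookup g j ≟ j)                 ≡⟨ *-comm _ (𝟙 (lookup g j ≟ j)) ⟩
        𝟙 (lookup g j ≟ j) * Πℕ-except j (edge g)                 ∎)
        where
        off-root : ∀ l → (if does (l ≟ j) then 1 else c l (lookup g l)) ≡ (if does (l ≟ j) then 1 else edge g l)
        off-root l with l ≟ j
        ... | yes _ = refl
        ... | no _  = refl
        root : c j (lookup g j) ≡ 𝟙 (lookup g j ≟ j)
        root = cong (λ b → if b then 𝟙 (lookup g j ≟ j) else edge g j) (dec-true (j ≟ j) refl)
      row-sum : ∀ l → sum (c l) ≡ (if does (l ≟ j) then 1 else sum (w l))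
      row-sum l with l ≟ j
      ... | yes _ = sum-𝟙ˡ j
      ... | no _  = refl

    treeSum-pos : ∀ {G j} → Rooted G j → G j ≡ j → (∀ l → l ≢ j → 0 < w l (G l)) → 0 < treeSum j
    treeSum-pos {G} {j} rooted Gj≡j positive = <-≤-trans tree-pos (≤-∑ᵐ n _ g)
      where
      g = tabulate G
      g≗G : ∀ l → lookup g l ≡ G l
      g≗G = lookup∘tabulate G
      edges-pos : ∀ l → 0 < (if does (l ≟ j) then 1 else edge g l)
      edges-pos l with l ≟ j
      ... | yes _   = s≤s z≤n
      ... | no l≢j = subst (λ x → 0 < w l x) (sym (g≗G l)) (positive l l≢j)
      tree-pos : 0 < 𝟙 (lookup g j ≟ j) * treeWeight j g
      tree-pos = *-mono-< (𝟙-pos (lookup g j ≟ j) (trans (g≗G j) Gj≡j))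
                   (*-mono-< (𝟙-pos (rooted? (lookup g) j) (rooted-cong (λ v _ → sym (g≗G v)) rooted))
                             (Πℕ-pos _ edges-pos))

  least-witness : ∀ {p} {P : ℕ → Set p} → (∀ k → Dec (P k)) → ∀ {k} → P k →
                  ∃[ m ] P m × (∀ {i} → i < m → ¬ P i)
  least-witness P? {zero}  p = 0 , p , λ ()
  least-witness P? {suc k} p with P? 0
  ... | yes p₀ = 0 , p₀ , λ ()
  ... | no ¬p₀ with least-witness (λ i → P? (suc i)) p
  ...   | m , pm , below = suc m , pm , λ { {zero} _ → ¬p₀ ; {suc i} i<m → below (s≤s⁻¹ i<m) }

  module SpanningTree {n : ℕ} (E : Fin n → Fin n → Set) (E? : ∀ u v → Dec (E u v)) (j : Fin n) where

    open import Relation.Nullary.Decidable using (_⊎-dec_; _×-dec_)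

    Near : ℕ → Fin n → Set
    Near zero    v = v ≡ j
    Near (suc k) v = Near k v ⊎ ∃[ u ] E v u × Near k u

    near? : ∀ k v → Dec (Near k v)
    near? zero    v = v ≟ j
    near? (suc k) v = near? k v ⊎-dec Finₚ.any? (λ u → E? v u ×-dec near? k u)

    module _ (connected : ∀ v → ∃[ k ] Near k v) where

      nearest : ∀ v → ∃[ m ] Near m v × (∀ {i} → i < m → ¬ Near i v)
      nearest v = least-witness (λ k → near? k v) (proj₂ (connected v))

      level : Fin n → ℕ
      level v = proj₁ (nearest v)

      level-least : ∀ {k u} → Near k u → level u ≤ k
      level-least {k} {u} near = ≮⇒≥ (λ k<level → proj₂ (proj₂ (nearest u)) k<level near)

      descend : ∀ v → v ≢ j → ∃[ u ] E v u × level u < level v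
      descend v v≢j with nearest v
      ... | zero  , near , _                = ⊥-elim (v≢j near)
      ... | suc m , inj₁ near , least       = ⊥-elim (least ≤-refl near)
      ... | suc m , inj₂ (u , e , near) , _ = u , e , s≤s (level-least near)

      parent : Fin n → Fin n
      parent v with v ≟ j
      ... | yes _   = j
      ... | no v≢j = proj₁ (descend v v≢j)

      parent-root : parent j ≡ j
      parent-root with j ≟ j
      ... | yes _   = refl
      ... | no j≢j = ⊥-elim (j≢j refl)

      parent-descends : ∀ v → v ≢ j → E v (parent v) × level (parent v) < level v
      parent-descends v v≢j with v ≟ j
      ... | yes v≡j = ⊥-elim (v≢j v≡j)
      ... | no v≢j  = proj₂ (descend v v≢j)

      reaches-root : ∀ k v → level v ≤ k → Reaches parent v j
      reaches-root k v level≤k with v ≟ j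
      ... | yes v≡j = 0 , v≡j
      reaches-root zero v level≤0 | no v≢j =
        ⊥-elim (n≮0 (≤-trans (proj₂ (parent-descends v v≢j)) level≤0))
      reaches-root (suc k) v level≤1+k | no v≢j
        with reaches-root k (parent v) (s≤s⁻¹ (≤-trans (proj₂ (parent-descends v v≢j)) level≤1+k))
      ... | k' , p = suc k' , trans (^ᶠ-sucʳ parent k' v) p

    spanning-tree : (∀ v → ∃[ k ] Near k v) → ∃[ G ] Rooted G j × G j ≡ j × (∀ v → v ≢ j → E v (G v))
    spanning-tree connected =
      parent connected , (λ v → reaches-root connected (level connected v) v ≤-refl) ,
      parent-root connected , (λ v v≢j → proj₁ (parent-descends connected v v≢j))

module Chains where

  open import Data.Integer as ℤ using (+_; -[1+_])
  import Data.Integer.Properties as ℤₚ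
  import Data.Nat as ℕ
  import Data.Nat.Coprimality as Coprime
  open import Data.Nat.Divisibility using (_∣_; divides; ∣-trans; 1∣_; ∣⇒≤)
  open import Data.Nat.GCD using (gcd)
  open import Data.Nat.LCM using (lcm; m∣lcm[m,n]; n∣lcm[m,n]; lcm-least; gcd*lcm)
  import Data.Nat.Properties as ℕₚ
  open import Data.Rational as ℚ
    using (ℚ; mkℚ; 0ℚ; 1ℚ; _+_; _*_; _-_; -_; _≤_; _<_; ↧ₙ_; 1/_; *≤*; *<*; positive; nonNegative)
  open import Data.Rational.Literals using (fromℤ)
  import Data.Rational.Properties as ℚₚ
  open import Data.Rational.Solver using (module +-*-Solver)
  import Data.Rational.Unnormalised.Base as ℚᵘ
  import Data.Rational.Unnormalised.Properties as ℚᵘₚ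
  open import Relation.Nullary.Decidable using (recompute)
  open import Algebra.Properties.Semiring.Sum ℕₚ.+-*-semiring using (sum)
  open import Algebra.Properties.CommutativeSemigroup
    (CommutativeMonoid.commutativeSemigroup ℚₚ.*-1-commutativeMonoid) using (xy∙z≈xz∙y)
  import Algebra.Properties.Semiring.Sum (Ring.semiring ℚₚ.+-*-ring) as ∑ℚ
  open Trees
  open ≡-Reasoning

  fromℕ : ℕ → ℚ
  fromℕ k = fromℤ (+ k)

  fromℕ-+ : ∀ a b → fromℕ (a ℕ.+ b) ≡ fromℕ a + fromℕ b
  fromℕ-+ a b =
    ℚₚ.toℚᵘ-injective (ℚᵘₚ.≃-sym (ℚᵘₚ.≃-trans (ℚₚ.toℚᵘ-homo-+ (fromℕ a) (fromℕ b)) (ℚᵘ.*≡* cross)))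
    where
    cross : (+ a ℤ.* + 1 ℤ.+ + b ℤ.* + 1) ℤ.* + 1 ≡ + (a ℕ.+ b) ℤ.* + 1
    cross = begin
      (+ a ℤ.* + 1 ℤ.+ + b ℤ.* + 1) ℤ.* + 1  ≡⟨ ℤₚ.*-identityʳ _ ⟩
      + a ℤ.* + 1 ℤ.+ + b ℤ.* + 1            ≡⟨ cong₂ ℤ._+_ (ℤₚ.*-identityʳ (+ a)) (ℤₚ.*-identityʳ (+ b)) ⟩
      + a ℤ.+ + b                            ≡⟨ sym (ℤₚ.pos-+ a b) ⟩
      + (a ℕ.+ b)                            ≡⟨ sym (ℤₚ.*-identityʳ _) ⟩
      + (a ℕ.+ b) ℤ.* + 1                    ∎

  fromℕ-* : ∀ a b → fromℕ (a ℕ.* b) ≡ fromℕ a * fromℕ b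
  fromℕ-* a b = ℚₚ.toℚᵘ-injective (ℚᵘₚ.≃-sym (ℚᵘₚ.≃-trans (ℚₚ.toℚᵘ-homo-* (fromℕ a) (fromℕ b))
                  (ℚᵘ.*≡* (cong (ℤ._* + 1) (sym (ℤₚ.pos-* a b))))))

  fromℕ-mono-≤ : ∀ {a b} → a ℕ.≤ b → fromℕ a ≤ fromℕ b
  fromℕ-mono-≤ {a} {b} a≤b =
    *≤* (subst₂ ℤ._≤_ (sym (ℤₚ.*-identityʳ (+ a))) (sym (ℤₚ.*-identityʳ (+ b))) (ℤ.+≤+ a≤b))

  fromℕ-nonneg : ∀ a → 0ℚ ≤ fromℕ a
  fromℕ-nonneg a = fromℕ-mono-≤ ℕ.z≤n

  fromℕ-pos : ∀ {a} → 0 ℕ.< a → 0ℚ < fromℕ a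
  fromℕ-pos {suc a} _ = *<* (ℤ.+<+ (ℕ.s≤s ℕ.z≤n))

  fromℕ-pos⁻¹ : ∀ {a} → 0ℚ < fromℕ a → 0 ℕ.< a
  fromℕ-pos⁻¹ {zero}  0<0 = ⊥-elim (ℚₚ.<-irrefl refl 0<0)
  fromℕ-pos⁻¹ {suc a} _   = ℕ.s≤s ℕ.z≤n

  fromℕ-injective : ∀ {a b} → fromℕ a ≡ fromℕ b → a ≡ b
  fromℕ-injective eq = ℤₚ.+-injective (cong ℚ.numerator eq)

  Σ≡sum : ∀ {n} (f : Fin n → ℚ) → Σ f ≡ ∑ℚ.sum f
  Σ≡sum {zero}  f = refl
  Σ≡sum {suc n} f = cong (λ x → f zero + x) (Σ≡sum (λ i → f (suc i)))

  Σ-cong : ∀ {n} {f g : Fin n → ℚ} → (∀ i → f i ≡ g i) → Σ f ≡ Σ g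
  Σ-cong {f = f} {g} f≗g = trans (Σ≡sum f) (trans (∑ℚ.sum-cong-≗ f≗g) (sym (Σ≡sum g)))

  Σ-distrib-+ : ∀ {n} (f g : Fin n → ℚ) → Σ (λ i → f i + g i) ≡ Σ f + Σ g
  Σ-distrib-+ f g =
    trans (Σ≡sum (λ i → f i + g i)) (trans (∑ℚ.∑-distrib-+ f g) (sym (cong₂ _+_ (Σ≡sum f) (Σ≡sum g))))

  *-distribˡ-Σ : ∀ {n} x (f : Fin n → ℚ) → x * Σ f ≡ Σ (λ i → x * f i)
  *-distribˡ-Σ x f =
    trans (cong (x *_) (Σ≡sum f)) (trans (∑ℚ.*-distribˡ-sum x f) (sym (Σ≡sum (λ i → x * f i))))

  *-distribʳ-Σ : ∀ {n} x (f : Fin n → ℚ) → Σ f * x ≡ Σ (λ i → f i * x)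
  *-distribʳ-Σ x f =
    trans (cong (_* x) (Σ≡sum f)) (trans (∑ℚ.*-distribʳ-sum x f) (sym (Σ≡sum (λ i → f i * x))))

  Σ-comm : ∀ {m n} (f : Fin m → Fin n → ℚ) → Σ (λ i → Σ (λ j → f i j)) ≡ Σ (λ j → Σ (λ i → f i j))
  Σ-comm f = begin
    Σ (λ i → Σ (λ j → f i j))            ≡⟨ Σ-cong (λ i → Σ≡sum (f i)) ⟩
    Σ (λ i → ∑ℚ.sum (f i))               ≡⟨ Σ≡sum (λ i → ∑ℚ.sum (f i)) ⟩
    ∑ℚ.sum (λ i → ∑ℚ.sum (f i))          ≡⟨ ∑ℚ.∑-comm f ⟩
    ∑ℚ.sum (λ j → ∑ℚ.sum (λ i → f i j))  ≡⟨ sym (Σ≡sum (λ j → ∑ℚ.sum (λ i → f i j))) ⟩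
    Σ (λ j → ∑ℚ.sum (λ i → f i j))       ≡⟨ sym (Σ-cong (λ j → Σ≡sum (λ i → f i j))) ⟩
    Σ (λ j → Σ (λ i → f i j))            ∎

  Σ-concentrated : ∀ {n} (f : Fin n → ℚ) a → (∀ i → i ≢ a → f i ≡ 0ℚ) → Σ f ≡ f a
  Σ-concentrated f a vanishes = trans (Σ≡sum f) (sum-concentrated ℚₚ.+-0-commutativeMonoid f a vanishes)

  fromℕ-sum : ∀ {n} (f : Fin n → ℕ) → fromℕ (sum f) ≡ Σ (λ i → fromℕ (f i))
  fromℕ-sum {zero}  f = refl
  fromℕ-sum {suc n} f =
    trans (fromℕ-+ (f zero) _) (cong (λ x → fromℕ (f zero) + x) (fromℕ-sum (λ i → f (suc i))))

  nonneg-* : ∀ {a b} → 0ℚ ≤ a → 0ℚ ≤ b → 0ℚ ≤ a * b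
  nonneg-* {a} {b} 0≤a 0≤b =
    ℚₚ.nonNegative⁻¹ (a * b) {{ℚₚ.nonNeg*nonNeg⇒nonNeg a {{nonNegative 0≤a}} b {{nonNegative 0≤b}}}}

  pos-* : ∀ {a b} → 0ℚ < a → 0ℚ < b → 0ℚ < a * b
  pos-* {a} {b} 0<a 0<b = ℚₚ.positive⁻¹ (a * b) {{ℚₚ.pos*pos⇒pos a {{positive 0<a}} b {{positive 0<b}}}}

  pos-*⁻¹ : ∀ {a b} → 0ℚ ≤ a → 0ℚ ≤ b → 0ℚ < a * b → 0ℚ < a × 0ℚ < b
  pos-*⁻¹ {a} {b} 0≤a 0≤b 0<ab =
    positive-factor 0≤a (λ a≡0 → trans (cong (_* b) a≡0) (ℚₚ.*-zeroˡ b)) ,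
    positive-factor 0≤b (λ b≡0 → trans (cong (a *_) b≡0) (ℚₚ.*-zeroʳ a))
    where
    positive-factor : ∀ {x} → 0ℚ ≤ x → (x ≡ 0ℚ → a * b ≡ 0ℚ) → 0ℚ < x
    positive-factor {x} 0≤x annihilates with 0ℚ ℚₚ.<? x
    ... | yes 0<x = 0<x
    ... | no 0≮x  = ⊥-elim (ℚₚ.<-irrefl (sym (annihilates (ℚₚ.≤-antisym (ℚₚ.≮⇒≥ 0≮x) 0≤x))) 0<ab)

  Σ-nonneg : ∀ {n} (f : Fin n → ℚ) → (∀ i → 0ℚ ≤ f i) → 0ℚ ≤ Σ f
  Σ-nonneg {zero}  f _      = ℚₚ.≤-refl
  Σ-nonneg {suc n} f nonneg = ℚₚ.+-mono-≤ (nonneg zero) (Σ-nonneg (λ i → f (suc i)) (λ i → nonneg (suc i)))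

  ≤-Σ : ∀ {n} (f : Fin n → ℚ) → (∀ i → 0ℚ ≤ f i) → ∀ a → f a ≤ Σ f
  ≤-Σ f nonneg zero =
    ℚₚ.≤-trans (ℚₚ.≤-reflexive (sym (ℚₚ.+-identityʳ (f zero))))
               (ℚₚ.+-monoʳ-≤ (f zero) (Σ-nonneg (λ i → f (suc i)) (λ i → nonneg (suc i))))
  ≤-Σ f nonneg (suc a) =
    ℚₚ.≤-trans (≤-Σ (λ i → f (suc i)) (λ i → nonneg (suc i)) a)
               (ℚₚ.≤-trans (ℚₚ.≤-reflexive (sym (ℚₚ.+-identityˡ _))) (ℚₚ.+-monoˡ-≤ _ (nonneg zero)))

  Σ-pos⁻¹ : ∀ {n} (f : Fin n → ℚ) → 0ℚ < Σ f → ∃[ i ] 0ℚ < f i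
  Σ-pos⁻¹ {zero}  f 0<0 = ⊥-elim (ℚₚ.<-irrefl refl 0<0)
  Σ-pos⁻¹ {suc n} f 0<Σ with 0ℚ ℚₚ.<? f zero
  ... | yes 0<f₀ = zero , 0<f₀
  ... | no 0≮f₀ with Σ-pos⁻¹ (λ i → f (suc i)) (ℚₚ.≰⇒> rest≰0)
    where
    rest≰0 : ¬ Σ (λ i → f (suc i)) ≤ 0ℚ
    rest≰0 rest≤0 = ℚₚ.<-irrefl refl (ℚₚ.<-≤-trans 0<Σ (ℚₚ.+-mono-≤ (ℚₚ.≮⇒≥ 0≮f₀) rest≤0))
  ... | i , 0<fᵢ = suc i , 0<fᵢ

  Invariant : ∀ {n} → Matrix n → Vector n → Set
  Invariant P u = ∀ j → Σ (λ i → u i * P i j) ≡ u j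

  module _ {n : ℕ} {P : Matrix n} where

    open +-*-Solver

    invariant-cong : ∀ {u v} → (∀ i → u i ≡ v i) → Invariant P u → Invariant P v
    invariant-cong {u} {v} u≗v inv j =
      trans (Σ-cong (λ i → cong (_* P i j) (sym (u≗v i)))) (trans (inv j) (u≗v j))

    invariant-*ʳ : ∀ {u} x → Invariant P u → Invariant P (λ i → u i * x)
    invariant-*ʳ {u} x inv j = begin
      Σ (λ i → u i * x * P i j)  ≡⟨ Σ-cong (λ i → xy∙z≈xz∙y (u i) x (P i j)) ⟩
      Σ (λ i → u i * P i j * x)  ≡⟨ sym (*-distribʳ-Σ x (λ i → u i * P i j)) ⟩
      Σ (λ i → u i * P i j) * x  ≡⟨ cong (_* x) (inv j) ⟩
      u j * x                    ∎

    invariant-*ʳ⁻¹ : ∀ {u x} → 0ℚ < x → Invariant P (λ i → u i * x) → Invariant P u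
    invariant-*ʳ⁻¹ {u} {x} 0<x inv j =
      ℚₚ.≤-antisym (ℚₚ.*-cancelʳ-≤-pos x {{positive 0<x}} (ℚₚ.≤-reflexive scaled))
                   (ℚₚ.*-cancelʳ-≤-pos x {{positive 0<x}} (ℚₚ.≤-reflexive (sym scaled)))
      where
      scaled : Σ (λ i → u i * P i j) * x ≡ u j * x
      scaled = begin
        Σ (λ i → u i * P i j) * x  ≡⟨ *-distribʳ-Σ x (λ i → u i * P i j) ⟩
        Σ (λ i → u i * P i j * x)  ≡⟨ Σ-cong (λ i → xy∙z≈xz∙y (u i) (P i j) x) ⟩
        Σ (λ i → u i * x * P i j)  ≡⟨ inv j ⟩
        u j * x                    ∎

    invariant-- : ∀ {u v} c → Invariant P u → Invariant P v → Invariant P (λ i → u i - c * v i)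
    invariant-- {u} {v} c inv-u inv-v j = begin
      Σ (λ i → (u i - c * v i) * P i j)
        ≡⟨ Σ-cong (λ i → solve 4 (λ a c b p → (a :- c :* b) :* p := a :* p :+ (:- c) :* (b :* p))
                                 refl (u i) c (v i) (P i j)) ⟩
      Σ (λ i → u i * P i j + (- c) * (v i * P i j))
        ≡⟨ Σ-distrib-+ (λ i → u i * P i j) (λ i → (- c) * (v i * P i j)) ⟩
      Σ (λ i → u i * P i j) + Σ (λ i → (- c) * (v i * P i j))
        ≡⟨ cong₂ _+_ (inv-u j)
                     (trans (sym (*-distribˡ-Σ (- c) (λ i → v i * P i j))) (cong ((- c) *_) (inv-v j))) ⟩
      u j + (- c) * v j
        ≡⟨ solve 3 (λ a c b → a :+ (:- c) :* b := a :- c :* b) refl (u j) c (v j) ⟩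
      u j - c * v j
        ∎

  I-diag : ∀ {n} (i : Fin n) → I i i ≡ 1ℚ
  I-diag i with i ≟ i
  ... | yes _   = refl
  ... | no i≢i = ⊥-elim (i≢i refl)

  I-off : ∀ {n} {i j : Fin n} → i ≢ j → I i j ≡ 0ℚ
  I-off {i = i} {j} i≢j with i ≟ j
  ... | yes i≡j = ⊥-elim (i≢j i≡j)
  ... | no _     = refl

  I-pos⁻¹ : ∀ {n} {i j : Fin n} → 0ℚ < I i j → i ≡ j
  I-pos⁻¹ {i = i} {j} 0<I with i ≟ j
  ... | yes i≡j = i≡j
  ... | no _     = ⊥-elim (ℚₚ.<-irrefl refl 0<I)

  invariant-^ᴹ : ∀ {n} {P : Matrix n} {u} → Invariant P u → ∀ k → Invariant (P ^ᴹ k) u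
  invariant-^ᴹ {u = u} inv zero j =
    trans (Σ-concentrated _ j (λ i i≢j → trans (cong (u i *_) (I-off i≢j)) (ℚₚ.*-zeroʳ (u i))))
          (trans (cong (u j *_) (I-diag j)) (ℚₚ.*-identityʳ (u j)))
  invariant-^ᴹ {P = P} {u} inv (suc k) j = begin
    Σ (λ i → u i * Σ (λ l → P i l * Pᵏ l j))
      ≡⟨ Σ-cong (λ i → trans (*-distribˡ-Σ (u i) (λ l → P i l * Pᵏ l j))
                             (Σ-cong (λ l → sym (ℚₚ.*-assoc (u i) (P i l) (Pᵏ l j))))) ⟩
    Σ (λ i → Σ (λ l → u i * P i l * Pᵏ l j))
      ≡⟨ Σ-comm (λ i l → u i * P i l * Pᵏ l j) ⟩
    Σ (λ l → Σ (λ i → u i * P i l * Pᵏ l j))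
      ≡⟨ Σ-cong (λ l → trans (sym (*-distribʳ-Σ (Pᵏ l j) (λ i → u i * P i l)))
                             (cong (_* Pᵏ l j) (inv l))) ⟩
    Σ (λ l → u l * Pᵏ l j)
      ≡⟨ invariant-^ᴹ inv k j ⟩
    u j
      ∎
    where
    Pᵏ = P ^ᴹ k

  ^ᴹ-nonneg : ∀ {n} {P : Matrix n} → (∀ i j → 0ℚ ≤ P i j) → ∀ k i j → 0ℚ ≤ (P ^ᴹ k) i j
  ^ᴹ-nonneg nonneg zero    i j with i ≟ j
  ... | yes _ = ℚₚ.nonNegative⁻¹ 1ℚ
  ... | no _  = ℚₚ.≤-refl
  ^ᴹ-nonneg nonneg (suc k) i j = Σ-nonneg _ (λ l → nonneg-* (nonneg i l) (^ᴹ-nonneg nonneg k l j))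

  argmin : ∀ {n} (f : Fin n → ℚ) → Fin n → ∃[ i ] ∀ j → f i ≤ f j
  argmin {suc zero}    f _ = zero , λ { zero → ℚₚ.≤-refl }
  argmin {suc (suc n)} f _ with argmin (λ i → f (suc i)) zero
  ... | i , min with f zero ℚₚ.≤? f (suc i)
  ...   | yes f₀≤ = zero , λ { zero → ℚₚ.≤-refl ; (suc j) → ℚₚ.≤-trans f₀≤ (min j) }
  ...   | no f₀≰  = suc i , λ { zero → ℚₚ.<⇒≤ (ℚₚ.≰⇒> f₀≰) ; (suc j) → min j }

  module IrreducibleChain {n : ℕ} (P : Matrix n) (nonneg : ∀ i j → 0ℚ ≤ P i j) (irreducible : Irreducible P)
                          where

    flow : ∀ {u} → Invariant P u → (∀ i → 0ℚ ≤ u i) → ∀ k a j → u a * (P ^ᴹ k) a j ≤ u j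
    flow {u} inv u≥0 k a j = ℚₚ.≤-trans (≤-Σ _ (λ i → nonneg-* (u≥0 i) (^ᴹ-nonneg nonneg k i j)) a)
                                        (ℚₚ.≤-reflexive (invariant-^ᴹ inv k j))

    invariant-pos : ∀ {u} → Invariant P u → (∀ i → 0ℚ ≤ u i) → ∀ {a} → 0ℚ < u a → ∀ j → 0ℚ < u j
    invariant-pos inv u≥0 {a} 0<ua j with irreducible a j
    ... | k , 0<Pᵏ = ℚₚ.<-≤-trans (pos-* 0<ua 0<Pᵏ) (flow inv u≥0 k a j)

    invariant-zero : ∀ {u} → Invariant P u → (∀ i → 0ℚ ≤ u i) → ∀ {a} → u a ≡ 0ℚ → ∀ j → u j ≡ 0ℚ
    invariant-zero {u} inv u≥0 {a} ua≡0 j with irreducible j a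
    ... | k , 0<Pᵏ = ℚₚ.≤-antisym (ℚₚ.≮⇒≥ 0≮uj) (u≥0 j)
      where
      0≮uj : ¬ 0ℚ < u j
      0≮uj 0<uj = ℚₚ.<-irrefl refl
        (ℚₚ.<-≤-trans (pos-* 0<uj 0<Pᵏ) (ℚₚ.≤-trans (flow inv u≥0 k j a) (ℚₚ.≤-reflexive ua≡0)))

    -- π - c z, for c the least ratio π i / z i, is a nonnegative invariant vector with a zero.
    invariant-proportional : ∀ {π z} → Invariant P π → (∀ i → 0ℚ ≤ π i) → Invariant P z → (∀ i → 0ℚ < z i) →
                             Fin n → ∃[ c ] ∀ j → π j ≡ c * z j
    invariant-proportional {π} {z} inv-π π≥0 inv-z z>0 j₀ = c , π≡cz
      where
      open +-*-Solver
      z≢0 : ∀ i → ℚ.NonZero (z i)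
      z≢0 i = ℚₚ.pos⇒nonZero (z i) {{positive (z>0 i)}}
      1/z : Fin n → ℚ
      1/z i = (1/ z i) {{z≢0 i}}
      ρ : Fin n → ℚ
      ρ i = π i * 1/z i
      ρz≡π : ∀ i → ρ i * z i ≡ π i
      ρz≡π i = begin
        ρ i * z i            ≡⟨ ℚₚ.*-assoc (π i) (1/z i) (z i) ⟩
        π i * (1/z i * z i)  ≡⟨ cong (π i *_) (ℚₚ.*-inverseˡ (z i) {{z≢0 i}}) ⟩
        π i * 1ℚ             ≡⟨ ℚₚ.*-identityʳ (π i) ⟩
        π i                  ∎
      i₀ = proj₁ (argmin ρ j₀)
      c = ρ i₀
      u : Fin n → ℚ
      u i = π i - c * z i
      cz≤π : ∀ i → c * z i ≤ π i
      cz≤π i = ℚₚ.≤-trans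
        (ℚₚ.*-monoʳ-≤-nonNeg (z i) {{nonNegative (ℚₚ.<⇒≤ (z>0 i))}} (proj₂ (argmin ρ j₀) i))
        (ℚₚ.≤-reflexive (ρz≡π i))
      u≥0 : ∀ i → 0ℚ ≤ u i
      u≥0 i = ℚₚ.≤-trans (ℚₚ.≤-reflexive (sym (ℚₚ.+-inverseʳ (c * z i)))) (ℚₚ.+-monoˡ-≤ (- (c * z i)) (cz≤π i))
      ui₀≡0 : u i₀ ≡ 0ℚ
      ui₀≡0 = trans (cong (λ x → π i₀ - x) (ρz≡π i₀)) (ℚₚ.+-inverseʳ (π i₀))
      π≡cz : ∀ j → π j ≡ c * z j
      π≡cz j = begin
        π j            ≡⟨ solve 3 (λ a c b → a := (a :- c :* b) :+ c :* b) refl (π j) c (z j) ⟩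
        u j + c * z j  ≡⟨ cong (_+ c * z j) (invariant-zero (invariant-- c inv-π inv-z) u≥0 ui₀≡0 j) ⟩
        0ℚ + c * z j   ≡⟨ ℚₚ.+-identityˡ (c * z j) ⟩
        c * z j        ∎

  clear-denominator : ∀ q d → 0ℚ ≤ q → ↧ₙ q ∣ d → ∃[ a ] fromℕ a ≡ fromℕ d * q
  clear-denominator (mkℚ -[1+ _ ] _ _) _ (*≤* ()) _
  clear-denominator q@(mkℚ (+ m) e _) d _ (divides k refl) =
    k ℕ.* m ,
    ℚₚ.toℚᵘ-injective (ℚᵘₚ.≃-sym (ℚᵘₚ.≃-trans (ℚₚ.toℚᵘ-homo-* (fromℕ (k ℕ.* suc e)) q) (ℚᵘ.*≡* cross)))
    where
    open import Data.Nat.Solver using () renaming (module +-*-Solver to ℕ-Solver)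
    open ℕ-Solver
    cross : (+ (k ℕ.* suc e) ℤ.* + m) ℤ.* + 1 ≡ + (k ℕ.* m) ℤ.* + (1 ℕ.* suc e)
    cross = begin
      (+ (k ℕ.* suc e) ℤ.* + m) ℤ.* + 1  ≡⟨ cong (ℤ._* + 1) (sym (ℤₚ.pos-* (k ℕ.* suc e) m)) ⟩
      + (k ℕ.* suc e ℕ.* m) ℤ.* + 1      ≡⟨ sym (ℤₚ.pos-* (k ℕ.* suc e ℕ.* m) 1) ⟩
      + (k ℕ.* suc e ℕ.* m ℕ.* 1)        ≡⟨ cong +_ (solve 3 (λ k s m → k :* s :* m :* con 1 := k :* m :* (con 1 :* s))
                                                          refl k (suc e) m) ⟩
      + (k ℕ.* m ℕ.* (1 ℕ.* suc e))      ≡⟨ ℤₚ.pos-* (k ℕ.* m) (1 ℕ.* suc e) ⟩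
      + (k ℕ.* m) ℤ.* + (1 ℕ.* suc e)    ∎

  -- The numerator m and denominator e + 1 of q are coprime and (e + 1) ∣ m S.
  denominator-∣ : ∀ q S y → 0ℚ ≤ q → q * fromℕ S ≡ fromℕ y → ↧ₙ q ∣ S
  denominator-∣ (mkℚ -[1+ _ ] _ _) _ _ (*≤* ()) _
  denominator-∣ q@(mkℚ (+ m) e coprime) S y _ qS≡y = Coprime.coprime-divisor den⊥num (divides y m*S≡y*den)
    where
    den⊥num : Coprime.Coprime (suc e) m
    den⊥num = Coprime.sym (recompute (Coprime.coprime? m (suc e)) coprime)
    cross : (+ m ℤ.* + S) ℤ.* + 1 ≡ + y ℤ.* + (suc e ℕ.* 1)
    cross with ℚᵘₚ.≃-trans (ℚᵘₚ.≃-sym (ℚₚ.toℚᵘ-homo-* q (fromℕ S))) (ℚₚ.toℚᵘ-cong qS≡y)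
    ... | ℚᵘ.*≡* eq = eq
    m*S≡y*den : m ℕ.* S ≡ y ℕ.* suc e
    m*S≡y*den = ℤₚ.+-injective (begin
      + (m ℕ.* S)              ≡⟨ cong +_ (sym (ℕₚ.*-identityʳ (m ℕ.* S))) ⟩
      + (m ℕ.* S ℕ.* 1)        ≡⟨ ℤₚ.pos-* (m ℕ.* S) 1 ⟩
      + (m ℕ.* S) ℤ.* + 1      ≡⟨ cong (ℤ._* + 1) (ℤₚ.pos-* m S) ⟩
      (+ m ℤ.* + S) ℤ.* + 1    ≡⟨ cross ⟩
      + y ℤ.* + (suc e ℕ.* 1)  ≡⟨ sym (ℤₚ.pos-* y (suc e ℕ.* 1)) ⟩
      + (y ℕ.* (suc e ℕ.* 1))  ≡⟨ cong (λ x → + (y ℕ.* x)) (ℕₚ.*-identityʳ (suc e)) ⟩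
      + (y ℕ.* suc e)          ∎)

  ↧-∣-lcd : ∀ {n} (v : Vector n) i → ↧ₙ v i ∣ lcd v
  ↧-∣-lcd v zero    = m∣lcm[m,n] (↧ₙ v zero) (lcd (λ j → v (suc j)))
  ↧-∣-lcd v (suc i) = ∣-trans (↧-∣-lcd (λ j → v (suc j)) i) (n∣lcm[m,n] (↧ₙ v zero) (lcd (λ j → v (suc j))))

  lcd-least : ∀ {n} (v : Vector n) {S} → (∀ i → ↧ₙ v i ∣ S) → lcd v ∣ S
  lcd-least {zero}  v {S} _   = 1∣ S
  lcd-least {suc n} v     ↧∣S = lcm-least (↧∣S zero) (lcd-least (λ j → v (suc j)) (λ i → ↧∣S (suc i)))

  ∣-lcmℕ : ∀ {n} (f : Fin n → ℕ) i → f i ∣ lcmℕ f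
  ∣-lcmℕ f zero    = m∣lcm[m,n] (f zero) (lcmℕ (λ j → f (suc j)))
  ∣-lcmℕ f (suc i) = ∣-trans (∣-lcmℕ (λ j → f (suc j)) i) (n∣lcm[m,n] (f zero) (lcmℕ (λ j → f (suc j))))

  lcm-pos : ∀ {a b} → 0 ℕ.< a → 0 ℕ.< b → 0 ℕ.< lcm a b
  lcm-pos {a} {b} 0<a 0<b = ℕₚ.n≢0⇒n>0 λ lcm≡0 → ℕₚ.<⇒≢ (ℕₚ.*-mono-< 0<a 0<b) (sym (begin
    a ℕ.* b              ≡⟨ sym (gcd*lcm a b) ⟩
    gcd a b ℕ.* lcm a b  ≡⟨ cong (gcd a b ℕ.*_) lcm≡0 ⟩
    gcd a b ℕ.* 0        ≡⟨ ℕₚ.*-zeroʳ (gcd a b) ⟩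
    0                    ∎))

  lcd-pos : ∀ {n} (v : Vector n) → 0 ℕ.< lcd v
  lcd-pos {zero}  v = ℕ.s≤s ℕ.z≤n
  lcd-pos {suc n} v = lcm-pos (ℕ.s≤s ℕ.z≤n) (lcd-pos (λ j → v (suc j)))

  lcmℕ-pos : ∀ {n} (f : Fin n → ℕ) → (∀ i → 0 ℕ.< f i) → 0 ℕ.< lcmℕ f
  lcmℕ-pos {zero}  f _   = ℕ.s≤s ℕ.z≤n
  lcmℕ-pos {suc n} f pos = lcm-pos (pos zero) (lcmℕ-pos (λ j → f (suc j)) (λ i → pos (suc i)))

  module Normalisation {n : ℕ} (P : Matrix n) (nonneg : ∀ i j → 0ℚ ≤ P i j) (irreducible : Irreducible P)
                       (y : Fin n → ℕ) (invariant-y : Invariant P (λ i → fromℕ (y i)))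
                       {a : Fin n} (0<ya : 0 ℕ.< y a) where

    open IrreducibleChain P nonneg irreducible

    z : Vector n
    z i = fromℕ (y i)

    z>0 : ∀ j → 0ℚ < z j
    z>0 = invariant-pos invariant-y (λ i → fromℕ-nonneg (y i)) (fromℕ-pos 0<ya)

    S : ℕ
    S = sum y

    0<S : 0 ℕ.< S
    0<S = ℕₚ.<-≤-trans 0<ya (≤-sum y a)

    Σz≡S : Σ z ≡ fromℕ S
    Σz≡S = sym (fromℕ-sum y)

    S≢0 : ℚ.NonZero (fromℕ S)
    S≢0 = ℚₚ.pos⇒nonZero (fromℕ S) {{positive (fromℕ-pos 0<S)}}

    1/S : ℚ
    1/S = (1/ fromℕ S) {{S≢0}}

    0<1/S : 0ℚ < 1/S
    0<1/S = ℚₚ.positive⁻¹ 1/S {{ℚₚ.1/pos⇒pos (fromℕ S) {{positive (fromℕ-pos 0<S)}}}}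

    S*1/S≡1 : fromℕ S * 1/S ≡ 1ℚ
    S*1/S≡1 = trans (ℚₚ.*-comm (fromℕ S) 1/S) (ℚₚ.*-inverseˡ (fromℕ S) {{S≢0}})

    stationary : StationaryDistribution P (λ j → z j * 1/S)
    stationary =
      (λ j → pos-* (z>0 j) 0<1/S) ,
      (λ j → ℚₚ.≤-trans (ℚₚ.*-monoʳ-≤-nonNeg 1/S {{nonNegative (ℚₚ.<⇒≤ 0<1/S)}} (fromℕ-mono-≤ (≤-sum y j)))
                        (ℚₚ.≤-reflexive S*1/S≡1)) ,
      trans (sym (*-distribʳ-Σ 1/S z)) (trans (cong (_* 1/S) Σz≡S) S*1/S≡1) ,
      invariant-*ʳ 1/S invariant-y

    stationary-*-S : ∀ π → StationaryDistribution P π → ∀ j → π j * fromℕ S ≡ fromℕ (y j)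
    stationary-*-S π (π>0 , _ , Σπ≡1 , invariant-π) j = begin
      π j * fromℕ S    ≡⟨ cong₂ _*_ (π≡cz j) (sym Σz≡S) ⟩
      c * z j * Σ z    ≡⟨ cong (_* Σ z) (ℚₚ.*-comm c (z j)) ⟩
      z j * c * Σ z    ≡⟨ ℚₚ.*-assoc (z j) c (Σ z) ⟩
      z j * (c * Σ z)  ≡⟨ cong (z j *_) (trans (*-distribˡ-Σ c z) (trans (sym (Σ-cong π≡cz)) Σπ≡1)) ⟩
      z j * 1ℚ         ≡⟨ ℚₚ.*-identityʳ (z j) ⟩
      z j              ∎
      where
      proportional = invariant-proportional invariant-π (λ i → ℚₚ.<⇒≤ (π>0 i)) invariant-y z>0 j
      c = proj₁ proportional
      π≡cz = proj₂ proportional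

    lcd-≤-sum : ∀ π → StationaryDistribution P π → lcd π ℕ.≤ S
    lcd-≤-sum π stat = ∣⇒≤ {{ℕ.>-nonZero 0<S}}
      (lcd-least π (λ j → denominator-∣ (π j) S (y j) (ℚₚ.<⇒≤ (proj₁ stat j)) (stationary-*-S π stat j)))

  module ScaledChain {n : ℕ} (P : Matrix n) (stochastic : Stochastic P) (irreducible : Irreducible P)
                     (c : Fin n → ℕ) (0<c : ∀ i → 0 ℕ.< c i) (c-clears : ∀ i k → ↧ₙ P i k ∣ c i) where

    nonneg : ∀ i j → 0ℚ ≤ P i j
    nonneg = proj₁ stochastic

    w : Fin n → Fin n → ℕ
    w i k = proj₁ (clear-denominator (P i k) (c i) (nonneg i k) (c-clears i k))

    fromℕ-w : ∀ i k → fromℕ (w i k) ≡ fromℕ (c i) * P i k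
    fromℕ-w i k = proj₂ (clear-denominator (P i k) (c i) (nonneg i k) (c-clears i k))

    row-sum : ∀ i → sum (w i) ≡ c i
    row-sum i = fromℕ-injective (begin
      fromℕ (sum (w i))              ≡⟨ fromℕ-sum (w i) ⟩
      Σ (λ k → fromℕ (w i k))        ≡⟨ Σ-cong (fromℕ-w i) ⟩
      Σ (λ k → fromℕ (c i) * P i k)  ≡⟨ sym (*-distribˡ-Σ (fromℕ (c i)) (P i)) ⟩
      fromℕ (c i) * Σ (P i)          ≡⟨ cong (fromℕ (c i) *_) (proj₂ (proj₂ stochastic) i) ⟩
      fromℕ (c i) * 1ℚ               ≡⟨ ℚₚ.*-identityʳ (fromℕ (c i)) ⟩
      fromℕ (c i)                    ∎)

    open TreeSums w using (treeSum; markov-chain-tree; treeSum-≤) public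

    invariant : Invariant P (λ i → fromℕ (treeSum i ℕ.* c i))
    invariant j = begin
      Σ (λ i → fromℕ (treeSum i ℕ.* c i) * P i j)  ≡⟨ Σ-cong scale ⟩
      Σ (λ i → fromℕ (treeSum i) * fromℕ (w i j))  ≡⟨ Σ-cong (λ i → sym (fromℕ-* (treeSum i) (w i j))) ⟩
      Σ (λ i → fromℕ (treeSum i ℕ.* w i j))        ≡⟨ sym (fromℕ-sum (λ i → treeSum i ℕ.* w i j)) ⟩
      fromℕ (sum (λ i → treeSum i ℕ.* w i j))      ≡⟨ cong fromℕ (markov-chain-tree j) ⟩
      fromℕ (treeSum j ℕ.* sum (w j))              ≡⟨ cong (λ x → fromℕ (treeSum j ℕ.* x)) (row-sum j) ⟩
      fromℕ (treeSum j ℕ.* c j)                    ∎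
      where
      scale : ∀ i → fromℕ (treeSum i ℕ.* c i) * P i j ≡ fromℕ (treeSum i) * fromℕ (w i j)
      scale i = begin
        fromℕ (treeSum i ℕ.* c i) * P i j          ≡⟨ cong (_* P i j) (fromℕ-* (treeSum i) (c i)) ⟩
        fromℕ (treeSum i) * fromℕ (c i) * P i j    ≡⟨ ℚₚ.*-assoc (fromℕ (treeSum i)) (fromℕ (c i)) (P i j) ⟩
        fromℕ (treeSum i) * (fromℕ (c i) * P i j)  ≡⟨ cong (fromℕ (treeSum i) *_) (sym (fromℕ-w i j)) ⟩
        fromℕ (treeSum i) * fromℕ (w i j)          ∎

    treeSum-invariant : ∀ {x} → (∀ i → c i ≡ x) → 0 ℕ.< x → Invariant P (λ i → fromℕ (treeSum i))
    treeSum-invariant {x} c≡x 0<x = invariant-*ʳ⁻¹ {P = P} (fromℕ-pos 0<x) (invariant-cong {P = P} scale invariant)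
      where
      scale : ∀ i → fromℕ (treeSum i ℕ.* c i) ≡ fromℕ (treeSum i) * fromℕ x
      scale i = trans (cong (λ y → fromℕ (treeSum i ℕ.* y)) (c≡x i)) (fromℕ-* (treeSum i) x)

    treeSum-≤-Πℕ-except : ∀ j → treeSum j ℕ.≤ Πℕ-except j c
    treeSum-≤-Πℕ-except j = ℕₚ.≤-trans (treeSum-≤ j)
      (ℕₚ.≤-reflexive (Πℕ-cong (λ l → cong (λ x → if does (l ≟ j) then 1 else x) (row-sum l))))

    treeSum*c-≤-Πℕ : ∀ j → treeSum j ℕ.* c j ℕ.≤ Πℕ c
    treeSum*c-≤-Πℕ j =
      ℕₚ.≤-trans (ℕₚ.*-monoˡ-≤ (c j) (treeSum-≤-Πℕ-except j)) (ℕₚ.≤-reflexive (sym (Πℕ-split c j)))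

    module _ (j : Fin n) where

      open SpanningTree (λ u v → 0ℚ < P u v) (λ u v → 0ℚ ℚₚ.<? P u v) j

      near-of-power : ∀ k v → 0ℚ < (P ^ᴹ k) v j → Near k v
      near-of-power zero    v 0<Ivj = I-pos⁻¹ 0<Ivj
      near-of-power (suc k) v 0<Pᵏ⁺¹ with Σ-pos⁻¹ _ 0<Pᵏ⁺¹
      ... | l , 0<PvlPᵏ with pos-*⁻¹ (nonneg v l) (^ᴹ-nonneg nonneg k l j) 0<PvlPᵏ
      ...   | 0<Pvl , 0<Pᵏ = inj₂ (l , 0<Pvl , near-of-power k l 0<Pᵏ)

      treeSum-pos : 0 ℕ.< treeSum j
      treeSum-pos with spanning-tree (λ v → proj₁ (irreducible v j) , near-of-power _ v (proj₂ (irreducible v j)))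
      ... | G , rooted , Gj≡j , positive-edges = TreeSums.treeSum-pos w rooted Gj≡j weight-pos
        where
        weight-pos : ∀ l → l ≢ j → 0 ℕ.< w l (G l)
        weight-pos l l≢j = fromℕ-pos⁻¹ (subst (0ℚ <_) (sym (fromℕ-w l (G l)))
                                               (pos-* (fromℕ-pos (0<c l)) (positive-edges l l≢j)))

open import Data.Nat using (_*_; _^_; _∸_; _≤_; _⊓_; NonZero; ≢-nonZero⁻¹)
open import Data.Nat.Properties using (≤-trans; ≤-reflexive; ⊓-glb; *-mono-<)
open import Data.Nat.Divisibility using (∣-trans)
open Trees using (sum-≤-*; Πℕ-except-const)
open Chains

theorem1p1 : (n : ℕ) → .{{_ : NonZero n}} → (P : Matrix n) →
    Stochastic P → Irreducible P →
    (∃ λ π → StationaryDistribution P π) ×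
    (∀ π → StationaryDistribution P π →
      lcd π ≤ (n * Dprod P) ⊓ (n * lcdAll P ^ (n ∸ 1)))
theorem1p1 zero {{0≢0}} _ _ _ = ⊥-elim (≢-nonZero⁻¹ 0 {{0≢0}} refl)
theorem1p1 (suc m) P stochastic irreducible =
  (_ , ByRows.stationary) , λ π stationary → ⊓-glb (bound-D π stationary) (bound-M π stationary)
  where
  M = lcdAll P
  0<M = lcmℕ-pos (rowLcd P) (λ i → lcd-pos (P i))
  module Rows = ScaledChain P stochastic irreducible (rowLcd P) (λ i → lcd-pos (P i)) (λ i → ↧-∣-lcd (P i))
  module Common = ScaledChain P stochastic irreducible (λ _ → M) (λ _ → 0<M)
                              (λ i k → ∣-trans (↧-∣-lcd (P i) k) (∣-lcmℕ (rowLcd P) i))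
  y : Fin (suc m) → ℕ
  y i = Rows.treeSum i * rowLcd P i
  module ByRows = Normalisation P Rows.nonneg irreducible y Rows.invariant
                                {zero} (*-mono-< (Rows.treeSum-pos zero) (lcd-pos (P zero)))
  module ByCommon = Normalisation P Common.nonneg irreducible Common.treeSum
                                  (Common.treeSum-invariant (λ _ → refl) 0<M) {zero} (Common.treeSum-pos zero)
  bound-D : ∀ π → StationaryDistribution P π → lcd π ≤ suc m * Dprod P
  bound-D π stationary = ≤-trans (ByRows.lcd-≤-sum π stationary) (sum-≤-* y Rows.treeSum*c-≤-Πℕ)
  bound-M : ∀ π → StationaryDistribution P π → lcd π ≤ suc m * M ^ m
  bound-M π stationary = ≤-trans (ByCommon.lcd-≤-sum π stationary) (sum-≤-* Common.treeSum T≤Mᵐ)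
    where
    T≤Mᵐ : ∀ j → Common.treeSum j ≤ M ^ m
    T≤Mᵐ j = ≤-trans (Common.treeSum-≤-Πℕ-except j) (≤-reflexive (Πℕ-except-const j M))
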